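{- Let $D$ be an instance of Directed Reachability Graph Realizability in the Proper, Happy, Any-Non-strict or Simple-Non-strict variant, and let $C$ be an induced directed cycle of length at least $3$ in $D$. Then in every realization of $D$ there is at least one arc of $C$ that receives no label.
   Context: A directed temporal graph is a pair $(H,\lambda)$ where $H=(V,B)$ is a simple digraph and $\lambda:B\to 2^{\mathbb{N}}$ assigns each arc a finite, possibly empty, set of labels. A strict (resp. non-strict) temporal path from $u$ to $v$ is a sequence $(a_1,t_1),\dots,(a_\ell,t_\ell)$, $t_j\in\lambda(a_j)$, such that $a_1,\dots,a_\ell$ form a directed $u$-$v$ path and $t_1<\dots<t_\ell$ (resp. $t_1\le\dots\le t_\ell$). The strict (resp. non-strict) reachability graph is the digraph on $V$ with arc $(u,v)$, $u\ne v$, iff such a temporal path exists. A labeling is simple if each arc with nonempty label set has exactly one label; proper if no two arcs $(u,v),(v,w)$ forming a directed path share a label; happy if proper and simple. Directed Reachability Graph Realizability: given a simple digraph $D=(V,A)$, decide whether some directed temporal graph on $V$ has reachability graph equal to $D$ (such a labeling is a realization; only arcs of $D$ can receive labels). Variants: Any-/Simple-Non-strict (non-strict reachability, arbitrary/simple labeling), Proper and Happy (proper/happy labeling). An induced directed cycle in $D$ is a directed cycle $v_1\to v_2\to\dots\to v_\ell\to v_1$ such that $D$ has no other arcs among $v_1,\dots,v_\ell$. -}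

module Defs where

open import Data.Nat using (ℕ; zero; suc; _<_; _≤_)
open import Data.Fin using (Fin; toℕ)
open import Data.List using (List; []; _∷_)
open import Data.List.Membership.Propositional using (_∈_)
open import Data.List.Relation.Unary.Unique.Propositional using (Unique)
open import Data.Product using (Σ; ∃; _×_)
open import Data.Sum using (_⊎_)
open import Data.Empty using (⊥)
open import Data.Unit using (⊤)
open import Relation.Nullary using (¬_)
open import Relation.Binary.PropositionalEquality using (_≡_; _≢_)
open import Function.Bundles using (_⇔_)

Digraph : ℕ → Set₁
Digraph n = Fin n → Fin n → Set

-- simple digraph: no loops (no multi-arcs is automatic for a relation)
Simple : ∀ {n} → Digraph n → Set
Simple {n} D = (u : Fin n) → ¬ D u u

-- A labeling assigns to each ordered pair a finite set (list) of labels.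
Labeling : ℕ → Set
Labeling n = Fin n → Fin n → List ℕ

SupportedBy : ∀ {n} → Digraph n → Labeling n → Set
SupportedBy {n} D λ' = (u v : Fin n) (t : ℕ) → t ∈ λ' u v → D u v

-- Temporal journey from u to v whose first label is t, with time order R
-- between consecutive labels (R = _<_ strict, R = _≤_ non-strict).
data Journey {n} (R : ℕ → ℕ → Set) (λ' : Labeling n) : Fin n → Fin n → ℕ → Set where
  one  : ∀ {u v t} → t ∈ λ' u v → Journey R λ' u v t
  step : ∀ {u w v t t'} → t ∈ λ' u w → R t t' → Journey R λ' w v t' →
         Journey R λ' u v t

verts : ∀ {n R λ' u v t} → Journey {n} R λ' u v t → List (Fin n)
verts (one {u} {v} _) = u ∷ v ∷ []
verts (step {u} _ _ j) = u ∷ verts j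

TemporalPath : ∀ {n} → (ℕ → ℕ → Set) → Labeling n → Fin n → Fin n → Set
TemporalPath R λ' u v = Σ ℕ λ t → Σ (Journey R λ' u v t) λ j → Unique (verts j)

ReachArc : ∀ {n} → (ℕ → ℕ → Set) → Labeling n → Digraph n
ReachArc R λ' u v = (u ≢ v) × TemporalPath R λ' u v

StrictReach NonStrictReach : ∀ {n} → Labeling n → Digraph n
StrictReach = ReachArc _<_
NonStrictReach = ReachArc _≤_

SimpleLabeling : ∀ {n} → Labeling n → Set
SimpleLabeling {n} λ' = (u v : Fin n) → (λ' u v ≡ []) ⊎ (∃ λ t → λ' u v ≡ t ∷ [])

ProperLabeling : ∀ {n} → Labeling n → Set
ProperLabeling {n} λ' = (u v w : Fin n) → u ≢ w → (t : ℕ) →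
  t ∈ λ' u v → t ∈ λ' v w → ⊥

HappyLabeling : ∀ {n} → Labeling n → Set
HappyLabeling λ' = ProperLabeling λ' × SimpleLabeling λ'

data Variant : Set where
  Proper Happy AnyNonStrict SimpleNonStrict : Variant

Allowed : Variant → ∀ {n} → Labeling n → Set
Allowed Proper          λ' = ProperLabeling λ'
Allowed Happy           λ' = HappyLabeling λ'
Allowed AnyNonStrict    λ' = ⊤
Allowed SimpleNonStrict λ' = SimpleLabeling λ'

-- reachability notion of a variant (proper/happy: strict; in proper
-- labelings strict and non-strict reachability coincide)
Reach : Variant → ∀ {n} → Labeling n → Digraph n
Reach Proper          = StrictReach
Reach Happy           = StrictReach
Reach AnyNonStrict    = NonStrictReach
Reach SimpleNonStrict = NonStrictReach

Realization : ∀ {n} → Variant → Digraph n → Labeling n → Set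
Realization {n} V D λ' =
  SupportedBy D λ' × Allowed V λ' × ((u v : Fin n) → Reach V λ' u v ⇔ D u v)

CycSucc : (ℓ : ℕ) → Fin ℓ → Fin ℓ → Set
CycSucc ℓ i j = (suc (toℕ i) ≡ toℕ j) ⊎ ((suc (toℕ i) ≡ ℓ) × (toℕ j ≡ 0))

InducedCycle : ∀ {n} → Digraph n → (ℓ : ℕ) → (Fin ℓ → Fin n) → Set
InducedCycle {n} D ℓ c =
  ((i j : Fin ℓ) → c i ≡ c j → i ≡ j) ×
  ((i j : Fin ℓ) → D (c i) (c j) ⇔ CycSucc ℓ i j)

-- Suppose every arc of the induced cycle carries a label, and pick the cycle arc
-- c(i) → c(j) whose chosen label t is smallest; let c(j) → c(m) be the next arc,
-- with label t' ≥ t. Then c(i) → c(j) → c(m) is a non-strict temporal path, and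
-- in a proper labeling t ≠ t', so it is even strict. Hence c(i) → c(m) is an arc
-- of the reachability graph, i.e. of D, which is a chord of the induced cycle.
module Submission where

open import Defs
open import Data.Nat using (ℕ; suc; _≤_; _<_; s≤s)
open import Data.Nat.Properties using (≤∧≢⇒<; <⇒≤; _≟_)
open import Data.Fin using (Fin; toℕ; fromℕ<) renaming (zero to fzero)
open import Data.Fin.Properties using (toℕ-fromℕ<; toℕ<n; any?)
open import Data.List using (List; []; _∷_; allFin)
open import Data.List.Properties using (≡-dec)
open import Data.List.Membership.Propositional using (_∈_)
open import Data.List.Membership.Propositional.Properties using (∈-allFin)
open import Data.List.Relation.Unary.Any using (here)
open import Data.List.Relation.Unary.All using ([]; _∷_)
open import Data.List.Relation.Unary.AllPairs using ([]; _∷_)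
import Data.List.Relation.Unary.All as All
open import Data.List.Extrema.Nat using (argmin; f[argmin]≤f[xs])
open import Data.Product using (∃; Σ; _×_; _,_; proj₁; proj₂)
open import Data.Sum using (_⊎_; inj₁; inj₂)
open import Data.Empty using (⊥-elim)
open import Relation.Nullary using (¬_; yes; no)
open import Relation.Binary.PropositionalEquality using (_≡_; _≢_; refl; sym; cong)
open import Function.Bundles using (Equivalence)

-- CycSucc ℓ i j unfolds to SuccMod ℓ (toℕ i) (toℕ j).
SuccMod : ℕ → ℕ → ℕ → Set
SuccMod ℓ a b = (suc a ≡ b) ⊎ ((suc a ≡ ℓ) × (b ≡ 0))

succMod-irrefl : ∀ {ℓ a b} → 2 ≤ ℓ → SuccMod ℓ a b → a ≢ b
succMod-irrefl _        (inj₁ refl)          ()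
succMod-irrefl (s≤s ()) (inj₂ (refl , refl)) refl

succMod²-irrefl : ∀ {ℓ a b d} → 3 ≤ ℓ → SuccMod ℓ a b → SuccMod ℓ b d → a ≢ d
succMod²-irrefl _              (inj₁ refl)          (inj₁ refl)          ()
succMod²-irrefl (s≤s (s≤s ())) (inj₁ refl)          (inj₂ (refl , refl)) refl
succMod²-irrefl (s≤s (s≤s ())) (inj₂ (refl , refl)) (inj₁ refl)          refl

succMod²-¬succMod : ∀ {ℓ a b d} → 2 ≤ ℓ → SuccMod ℓ a b → SuccMod ℓ b d → ¬ SuccMod ℓ a d
succMod²-¬succMod _        (inj₁ refl)          (inj₁ refl)          (inj₁ ())
succMod²-¬succMod _        (inj₁ refl)          (inj₁ refl)          (inj₂ (_ , ()))
succMod²-¬succMod _        (inj₁ refl)          (inj₂ (refl , refl)) (inj₁ ())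
succMod²-¬succMod _        (inj₁ refl)          (inj₂ (refl , refl)) (inj₂ (() , _))
succMod²-¬succMod (s≤s ()) (inj₂ (refl , refl)) (inj₁ refl)          (inj₁ refl)
succMod²-¬succMod _        (inj₂ (refl , refl)) (inj₁ refl)          (inj₂ (_ , ()))
succMod²-¬succMod (s≤s ()) (inj₂ (refl , refl)) (inj₂ (refl , refl)) _

cycSucc-next : ∀ {k} (i : Fin (suc k)) → Σ (Fin (suc k)) (CycSucc (suc k) i)
cycSucc-next {k} i with suc (toℕ i) ≟ suc k
... | yes last = fzero , inj₂ (last , refl)
... | no ¬last = fromℕ< i+1<ℓ , inj₁ (sym (toℕ-fromℕ< i+1<ℓ))
  where i+1<ℓ = ≤∧≢⇒< (toℕ<n i) ¬last

cycNext : ∀ {k} → Fin (suc k) → Fin (suc k)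
cycNext i = proj₁ (cycSucc-next i)

cycSucc-cycNext : ∀ {k} (i : Fin (suc k)) → CycSucc (suc k) i (cycNext i)
cycSucc-cycNext i = proj₂ (cycSucc-next i)

twoArcs⇒ReachArc : ∀ {n R} {λ' : Labeling n} {a b d t t'} →
  a ≢ b → a ≢ d → b ≢ d → t ∈ λ' a b → t' ∈ λ' b d → R t t' → ReachArc R λ' a d
twoArcs⇒ReachArc a≢b a≢d b≢d t∈ab t'∈bd Rtt' =
  a≢d , _ , step t∈ab Rtt' (one t'∈bd) , (a≢b ∷ a≢d ∷ []) ∷ (b≢d ∷ []) ∷ [] ∷ []

proper⇒twoArcs-< : ∀ {n} {λ' : Labeling n} {a b d t t'} → ProperLabeling λ' →
  a ≢ d → t ∈ λ' a b → t' ∈ λ' b d → t ≤ t' → t < t'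
proper⇒twoArcs-< proper a≢d t∈ab t'∈bd t≤t' =
  ≤∧≢⇒< t≤t' λ { refl → proper _ _ _ a≢d _ t∈ab t'∈bd }

twoArcs⇒Reach : ∀ V {n} {λ' : Labeling n} {a b d t t'} → Allowed V λ' →
  a ≢ b → a ≢ d → b ≢ d → t ∈ λ' a b → t' ∈ λ' b d → t ≤ t' → Reach V λ' a d
twoArcs⇒Reach Proper proper ab ad bd t∈ t'∈ le =
  twoArcs⇒ReachArc ab ad bd t∈ t'∈ (proper⇒twoArcs-< proper ad t∈ t'∈ le)
twoArcs⇒Reach Happy (proper , _) ab ad bd t∈ t'∈ le =
  twoArcs⇒ReachArc ab ad bd t∈ t'∈ (proper⇒twoArcs-< proper ad t∈ t'∈ le)
twoArcs⇒Reach AnyNonStrict    _ ab ad bd t∈ t'∈ le = twoArcs⇒ReachArc ab ad bd t∈ t'∈ le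
twoArcs⇒Reach SimpleNonStrict _ ab ad bd t∈ t'∈ le = twoArcs⇒ReachArc ab ad bd t∈ t'∈ le

inducedCycle-no-nondecreasing-twoArcs :
  ∀ V {n} {D : Digraph n} {ℓ} {c : Fin ℓ → Fin n} {λ'} → 3 ≤ ℓ →
  InducedCycle D ℓ c → Realization V D λ' →
  ∀ {i j m t t'} → CycSucc ℓ i j → CycSucc ℓ j m →
  t ∈ λ' (c i) (c j) → t' ∈ λ' (c j) (c m) → ¬ t ≤ t'
inducedCycle-no-nondecreasing-twoArcs V {D = D} {c = c} ℓ≥3 (c-inj , c-arcs)
  (_ , allowed , reach) {i} {j} {m} ij jm t∈ t'∈ t≤t' =
  succMod²-¬succMod ℓ≥2 ij jm (Equivalence.to (c-arcs i m) chord)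
  where
  ℓ≥2 = <⇒≤ ℓ≥3
  c-distinct : ∀ {x y} → toℕ x ≢ toℕ y → c x ≢ c y
  c-distinct x≢y cx≡cy = x≢y (cong toℕ (c-inj _ _ cx≡cy))
  chord : D (c i) (c m)
  chord = Equivalence.to (reach _ _) (twoArcs⇒Reach V allowed
    (c-distinct (succMod-irrefl ℓ≥2 ij)) (c-distinct (succMod²-irrefl ℓ≥3 ij jm))
    (c-distinct (succMod-irrefl ℓ≥2 jm)) t∈ t'∈ t≤t')

nonEmpty⇒∃∈ : ∀ {A : Set} (xs : List A) → xs ≢ [] → ∃ (_∈ xs)
nonEmpty⇒∃∈ []      xs≢[] = ⊥-elim (xs≢[] refl)
nonEmpty⇒∃∈ (x ∷ _) _     = x , here refl

lemma59 : (V : Variant) (n : ℕ) (D : Digraph n) → Simple D →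
    (ℓ : ℕ) → 3 ≤ ℓ → (c : Fin ℓ → Fin n) → InducedCycle D ℓ c →
    (λ' : Labeling n) → Realization V D λ' →
    Σ (Fin ℓ) λ i → Σ (Fin ℓ) λ j → CycSucc ℓ i j × (λ' (c i) (c j) ≡ [])
lemma59 V n D _ (suc k) ℓ≥3 c cycle λ' realization
  with any? (λ i → ≡-dec _≟_ (λ' (c i) (c (cycNext i))) [])
... | yes (i , unlabelled) = i , cycNext i , cycSucc-cycNext i , unlabelled
... | no allLabelled = ⊥-elim (inducedCycle-no-nondecreasing-twoArcs V ℓ≥3 cycle realization
        (cycSucc-cycNext i) (cycSucc-cycNext j) (label∈ i) (label∈ j) (label-minimal j))
  where
  labelled : ∀ x → ∃ (_∈ λ' (c x) (c (cycNext x)))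
  labelled x = nonEmpty⇒∃∈ _ λ unlabelled → allLabelled (x , unlabelled)
  label : Fin (suc k) → ℕ
  label x = proj₁ (labelled x)
  label∈ : ∀ x → label x ∈ λ' (c x) (c (cycNext x))
  label∈ x = proj₂ (labelled x)
  i j : Fin (suc k)
  i = argmin label fzero (allFin (suc k))
  j = cycNext i
  label-minimal : ∀ x → label i ≤ label x
  label-minimal x = All.lookup (f[argmin]≤f[xs] {f = label} fzero (allFin (suc k))) (∈-allFin x)
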